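{- Let $\Gamma$ be the semigroup associated to an irreducible plane curve singularity, minimally generated by $r_0<r_1<\cdots<r_h$, with $h\ge 2$. Then $r_h\ge \frac13\left(5\cdot 2^{2h-1}-1\right)$.
   Context: A numerical semigroup is a submonoid $\Gamma$ of $(\mathbb N,+)$ with finite complement in $\mathbb N$. $\langle X\rangle$ denotes the submonoid of $\mathbb N$ generated by $X$. For minimal generators listed in a fixed order $(r_0,\ldots,r_h)$, set $d_k=\gcd(r_0,\ldots,r_{k-1})$ for $k=1,\ldots,h+1$, $e_k=d_k/d_{k+1}$ for $k=1,\ldots,h$, and $\Gamma_k=\langle r_0/d_{k+1},\ldots,r_k/d_{k+1}\rangle$. Gluing: if $A$ is the minimal generating set of a numerical semigroup and $A=A_1\cup A_2$ is a nontrivial partition with $a_i=\gcd(A_i)$, then $A$ is the gluing of $A_1$ and $A_2$ if $\mathrm{lcm}(a_1,a_2)\in\langle A_1\rangle\cap\langle A_2\rangle$. $\Gamma$ is free for the arrangement $(r_0,\ldots,r_h)$ if either $h=0$ (so $r_0=1$) or $\{r_0,\ldots,r_h\}$ is the gluing of $\{r_0,\ldots,r_{h-1}\}$ and $\{r_h\}$ and $\Gamma_{h-1}$ is free for the arrangement $(r_0/d_h,\ldots,r_{h-1}/d_h)$. $\Gamma$ is telescopic if it is free for the increasing arrangement $r_0<\cdots<r_h$. $\Gamma$ is the semigroup associated to an irreducible plane curve singularity if it is telescopic and $e_kr_k<r_{k+1}$ for all $k=1,\ldots,h-1$. -}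

module Defs where

open import Data.Nat using (ℕ; zero; suc; _+_; _*_; _∸_; _≤_; _<_; _/_)
open import Data.Nat.GCD using (gcd)
open import Data.Nat.LCM using (lcm)
open import Data.List using (List; []; _∷_; _++_; [_]; map; upTo; foldr; length; lookup; removeAt)
open import Data.List.Membership.Propositional using (_∈_)
open import Data.Fin using (Fin)
open import Data.Product using (_×_; ∃)
open import Relation.Nullary using (¬_)
open import Relation.Binary.PropositionalEquality using (_≡_)

data ⟨_⟩∋_ (A : List ℕ) : ℕ → Set where
  zero∈ : ⟨ A ⟩∋ 0
  add∈  : ∀ {a n} → a ∈ A → ⟨ A ⟩∋ n → ⟨ A ⟩∋ (a + n)

IsNumerical : List ℕ → Set
IsNumerical A = ∃ λ c → ∀ n → c ≤ n → ⟨ A ⟩∋ n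

IsMinGenNS : List ℕ → Set
IsMinGenNS A = IsNumerical A × (∀ (i : Fin (length A)) → ¬ (⟨ removeAt A i ⟩∋ lookup A i))

gcdL : List ℕ → ℕ
gcdL = foldr gcd 0

-- total division (dividing by 0 gives 0; never used with divisor 0 in practice)
_div_ : ℕ → ℕ → ℕ
n div zero = 0
n div suc m = n / suc m

first : ℕ → (ℕ → ℕ) → List ℕ
first k r = map r (upTo k)

-- d_k = gcd(r_0,…,r_{k-1})
d : (ℕ → ℕ) → ℕ → ℕ
d r k = gcdL (first k r)

e : (ℕ → ℕ) → ℕ → ℕ
e r k = d r k div d r (suc k)

IsGluing : List ℕ → ℕ → Set
IsGluing A₁ y =
  IsMinGenNS (A₁ ++ [ y ]) ×
  (⟨ A₁ ⟩∋ lcm (gcdL A₁) y) × (⟨ [ y ] ⟩∋ lcm (gcdL A₁) y)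

Free : ℕ → (ℕ → ℕ) → Set
Free zero r = r 0 ≡ 1
Free (suc h) r =
  IsGluing (first (suc h) r) (r (suc h)) ×
  Free h (λ i → r i div d r (suc h))

IsTelescopic : ℕ → (ℕ → ℕ) → Set
IsTelescopic h r = (∀ i → i < h → r i < r (suc i)) × Free h r

IsPlaneCurveSemigroup : ℕ → (ℕ → ℕ) → Set
IsPlaneCurveSemigroup h r =
  IsTelescopic h r × (∀ k → 1 ≤ k → k ≤ h ∸ 1 → e r k * r k < r (suc k))

-- Freeness forbids d_k ∣ r_k (else r_k ∈ ⟨r_0,…,r_{k-1}⟩), so d_{k+1} is a proper divisor of
-- d_k: d_k ≥ 2 d_{k+1}, hence d_k ≥ 2^(h+1-k) and e_k ≥ 2. Then r_{k+1} > e_k r_k ≥ 2 r_k, and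
-- as d_{k+2} divides both, r_{k+1} ≥ 2 r_k + d_{k+2} ≥ 2 r_k + 2^(h-k-1). Starting from
-- r_0 ≥ 2^h and r_1 ≥ r_0 + d_2, induction on k gives 3 r_k + 2^(h-k) ≥ 5·2^(h+k-1).
module Submission where

open import Defs
open import Data.Nat using (ℕ; zero; suc; _+_; _*_; _∸_; _^_; _≤_; _<_; z≤n; s≤s; _/_; >-nonZero)
open import Data.Nat.Properties
open import Data.Nat.Divisibility
open import Data.Nat.DivMod using (m*n/n≡m; m/n*n≡m; /-mono-≤)
open import Data.Nat.GCD using (gcd[m,n]∣m; gcd[m,n]∣n; gcd-greatest)
open import Data.Nat.LCM using (lcm; lcm-least; n∣lcm[m,n])
open import Data.Nat.Tactic.RingSolver using (solve-∀)
open import Data.List using (List; []; _∷_; _++_; [_]; length; lookup; removeAt)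
open import Data.List.Membership.Propositional using (_∈_)
open import Data.List.Membership.Propositional.Properties using (∈-map⁺; ∈-map⁻; ∈-upTo⁺; ∈-upTo⁻)
open import Data.List.Relation.Unary.Any using (here; there)
open import Data.Fin using (Fin)
open import Data.Product using (_×_; ∃; _,_; proj₁; proj₂)
open import Data.Sum using (inj₁; inj₂)
open import Relation.Nullary using (¬_; contradiction)
open import Relation.Binary.PropositionalEquality hiding ([_])

gcdL-∣ : ∀ L {x} → x ∈ L → gcdL L ∣ x
gcdL-∣ (y ∷ L) (here refl) = gcd[m,n]∣m y (gcdL L)
gcdL-∣ (y ∷ L) (there x∈L) = ∣-trans (gcd[m,n]∣n y (gcdL L)) (gcdL-∣ L x∈L)

gcdL-greatest : ∀ L {g} → (∀ {x} → x ∈ L → g ∣ x) → g ∣ gcdL L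
gcdL-greatest []      g∣ = _ ∣0
gcdL-greatest (y ∷ L) g∣ = gcd-greatest (g∣ (here refl)) (gcdL-greatest L (λ x∈L → g∣ (there x∈L)))

d-∣ : ∀ r {k i} → i < k → d r k ∣ r i
d-∣ r {k} i<k = gcdL-∣ (first k r) (∈-map⁺ r (∈-upTo⁺ i<k))

d-greatest : ∀ r k {g} → (∀ {i} → i < k → g ∣ r i) → g ∣ d r k
d-greatest r k {g} g∣ = gcdL-greatest (first k r) g∣first
  where
  g∣first : ∀ {x} → x ∈ first k r → g ∣ x
  g∣first x∈ with ∈-map⁻ r x∈
  ... | i , i∈ , refl = g∣ (∈-upTo⁻ i∈)

d-suc-∣ : ∀ r k → d r (suc k) ∣ d r k
d-suc-∣ r k = d-greatest r k (λ i<k → d-∣ r (m<n⇒m<1+n i<k))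

-- Transports d r k ∣ r k to the rescaled sequence on which Free recurses.
d-div-∣ : ∀ r {k c} → (∀ {i} → i ≤ k → c ∣ r i) → d r k ∣ r k →
  d (λ i → r i div c) k ∣ r k div c
d-div-∣ r {c = zero}   _ _ = _ ∣0
d-div-∣ r {k} {suc c} c∣ dk∣rk =
  *-cancelʳ-∣ (suc c) (∣-trans g*c∣dk (subst (d r k ∣_) (sym (m/n*n≡m (c∣ ≤-refl))) dk∣rk))
  where
  g = d (λ i → r i div suc c) k
  g*c∣dk : g * suc c ∣ d r k
  g*c∣dk = d-greatest r k λ {i} i<k →
    subst (g * suc c ∣_) (m/n*n≡m (c∣ (<⇒≤ i<k))) (*-monoˡ-∣ (suc c) (d-∣ _ i<k))

last-index : ∀ (xs : List ℕ) y → ∃ λ (i : Fin (length (xs ++ [ y ]))) →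
  lookup (xs ++ [ y ]) i ≡ y × removeAt (xs ++ [ y ]) i ≡ xs
last-index []       y = Fin.zero , refl , refl
last-index (x ∷ xs) y with last-index xs y
... | i , lookup≡y , removeAt≡xs = Fin.suc i , lookup≡y , cong (x ∷_) removeAt≡xs

-- If gcd A ∣ y, then lcm (gcd A) y = y lies in ⟨ A ⟩, so y is not a minimal generator.
gluing⇒gcdL∤ : ∀ {A y} → IsGluing A y → ¬ (gcdL A ∣ y)
gluing⇒gcdL∤ {A} {y} ((_ , minimal) , lcm∈⟨A⟩ , _) gcd∣y with last-index A y
... | i , lookup≡y , removeAt≡A =
  minimal i (subst₂ ⟨_⟩∋_ (sym removeAt≡A) (trans lcm≡y (sym lookup≡y)) lcm∈⟨A⟩)
  where
  lcm≡y : lcm (gcdL A) y ≡ y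
  lcm≡y = ∣-antisym (lcm-least gcd∣y ∣-refl) (n∣lcm[m,n] (gcdL A) y)

Free⇒d∤ : ∀ m r → Free m r → ∀ {k} → 1 ≤ k → k ≤ m → ¬ (d r k ∣ r k)
Free⇒d∤ zero    r _ 1≤k k≤0 with () ← ≤-trans 1≤k k≤0
Free⇒d∤ (suc m) r (gluing , free) 1≤k k≤1+m dk∣rk with m≤n⇒m<n∨m≡n k≤1+m
... | inj₂ refl    = gluing⇒gcdL∤ gluing dk∣rk
... | inj₁ (s≤s k≤m) = Free⇒d∤ m _ free 1≤k k≤m
  (d-div-∣ r (λ i≤k → d-∣ r (s≤s (≤-trans i≤k k≤m))) dk∣rk)

∣-gap : ∀ {g a b} → g ∣ a → g ∣ b → a < b → a + g ≤ b
∣-gap {g} (divides p refl) (divides q refl) a<b =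
  subst (_≤ q * g) (+-comm g (p * g)) (*-monoˡ-≤ g (*-cancelʳ-< _ p q a<b))

∣∧≢⇒2*≤ : ∀ {a b} → a ∣ b → 0 < b → a ≢ b → 2 * a ≤ b
∣∧≢⇒2*≤ (divides 0 refl) () _
∣∧≢⇒2*≤ {a} (divides 1 refl) _ a≢b = contradiction (sym (+-identityʳ a)) a≢b
∣∧≢⇒2*≤ {a} (divides (suc (suc q)) refl) _ _ = *-monoˡ-≤ a {2} {2 + q} (s≤s (s≤s z≤n))

2*≤⇒2≤div : ∀ a b → 0 < b → 2 * b ≤ a → 2 ≤ a div b
2*≤⇒2≤div a (suc b) _ 2b≤a =
  subst (_≤ a / suc b) (m*n/n≡m 2 (suc b)) (/-mono-≤ {m = 2 * suc b} 2b≤a ≤-refl)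

base-arith : ∀ {P a b g} → 2 * P ≤ a → P ≤ g → a + g ≤ b → 5 * (2 * P) ≤ 3 * b + P
base-arith {P} {a} {b} {g} 2P≤a P≤g a+g≤b = begin
  5 * (2 * P)       ≡⟨ ring P ⟩
  3 * (2 * P + P) + P ≤⟨ +-monoˡ-≤ P (*-monoʳ-≤ 3 (≤-trans (+-mono-≤ 2P≤a P≤g) a+g≤b)) ⟩
  3 * b + P         ∎
  where
  open ≤-Reasoning
  ring : ∀ P → 5 * (2 * P) ≡ 3 * (2 * P + P) + P
  ring = solve-∀

step-arith : ∀ {P Q a b} → 5 * P ≤ 3 * a + 2 * Q → 2 * a + Q ≤ b → 5 * (2 * P) ≤ 3 * b + Q
step-arith {P} {Q} {a} {b} 5P≤ 2a+Q≤b = begin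
  5 * (2 * P)         ≡⟨ ring₁ P ⟩
  2 * (5 * P)         ≤⟨ *-monoʳ-≤ 2 5P≤ ⟩
  2 * (3 * a + 2 * Q) ≡⟨ ring₂ a Q ⟩
  3 * (2 * a + Q) + Q ≤⟨ +-monoˡ-≤ Q (*-monoʳ-≤ 3 2a+Q≤b) ⟩
  3 * b + Q           ∎
  where
  open ≤-Reasoning
  ring₁ : ∀ P → 5 * (2 * P) ≡ 2 * (5 * P)
  ring₁ = solve-∀
  ring₂ : ∀ a Q → 2 * (3 * a + 2 * Q) ≡ 3 * (2 * a + Q) + Q
  ring₂ = solve-∀

IsMinGenNS⇒head>0 : ∀ {x xs} → IsMinGenNS (x ∷ xs) → 0 < x
IsMinGenNS⇒head>0 {zero} (_ , minimal) with () ← minimal Fin.zero zero∈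
IsMinGenNS⇒head>0 {suc x} _ = s≤s z≤n

module PlaneCurveSemigroup {h r} (pc : IsPlaneCurveSemigroup h r) (r₀>0 : 0 < r 0) where

  increasing : ∀ i → i < h → r i < r (suc i)
  increasing = proj₁ (proj₁ pc)

  free : Free h r
  free = proj₂ (proj₁ pc)

  e*r<r : ∀ k → 1 ≤ k → k ≤ h ∸ 1 → e r k * r k < r (suc k)
  e*r<r = proj₂ pc

  d>0 : ∀ {k} → 1 ≤ k → 0 < d r k
  d>0 1≤k = n≢0⇒n>0 λ d≡0 → n>0⇒n≢0 r₀>0 (0∣⇒≡0 (subst (_∣ r 0) d≡0 (d-∣ r {i = 0} 1≤k)))

  d-halves : ∀ {k} → 1 ≤ k → k ≤ h → 2 * d r (suc k) ≤ d r k
  d-halves {k} 1≤k k≤h = ∣∧≢⇒2*≤ (d-suc-∣ r k) (d>0 1≤k)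
    λ d₁₊ₖ≡dₖ → Free⇒d∤ h r free 1≤k k≤h (subst (_∣ r k) d₁₊ₖ≡dₖ (d-∣ r {suc k} ≤-refl))

  2^≤d : ∀ {i} j → i + j ≡ h → 2 ^ j ≤ d r (suc i)
  2^≤d {i} zero _ = d>0 {suc i} (s≤s z≤n)
  2^≤d {i} (suc j) eq = ≤-trans (*-monoʳ-≤ 2 (2^≤d j eq′))
    (d-halves (s≤s z≤n) (subst (suc i ≤_) eq′ (m≤m+n (suc i) j)))
    where
    eq′ : suc i + j ≡ h
    eq′ = trans (sym (+-suc i j)) eq

  2≤e : ∀ {k} → 1 ≤ k → k ≤ h → 2 ≤ e r k
  2≤e {k} 1≤k k≤h = 2*≤⇒2≤div _ _ (d>0 {suc k} (s≤s z≤n)) (d-halves 1≤k k≤h)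

  r₀+d₂≤r₁ : 1 ≤ h → r 0 + d r 2 ≤ r 1
  r₀+d₂≤r₁ 1≤h = ∣-gap (d-∣ r {2} (s≤s z≤n)) (d-∣ r {2} ≤-refl) (increasing 0 1≤h)

  2*r+d≤r : ∀ {k} → 1 ≤ k → k ≤ h ∸ 1 → 2 * r k + d r (2 + k) ≤ r (suc k)
  2*r+d≤r {k} 1≤k k≤h∸1 = ∣-gap (∣n⇒∣m*n 2 (d-∣ r (m<n⇒m<1+n (n<1+n k)))) (d-∣ r {2 + k} ≤-refl)
    (≤-<-trans (*-monoˡ-≤ (r k) (2≤e 1≤k (≤pred⇒≤ k≤h∸1))) (e*r<r k 1≤k k≤h∸1))

  -- The invariant 5·2^(h+k-1) ≤ 3 r_k + 2^(h-k) for k = 1 + t, with j = h - k.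
  bound : ∀ t j → suc t + j ≡ h → 5 * 2 ^ (t + h) ≤ 3 * r (suc t) + 2 ^ j
  bound zero j refl = base-arith {2 ^ j} {r 0} {r 1} {d r 2}
    (≤-trans (2^≤d {0} (suc j) refl) (∣⇒≤ ⦃ >-nonZero r₀>0 ⦄ (d-∣ r {1} {0} (s≤s z≤n))))
    (2^≤d {1} j refl) (r₀+d₂≤r₁ (s≤s z≤n))
  bound (suc t) j eq = step-arith {2 ^ (t + h)} {2 ^ j} {r (suc t)} {r (2 + t)}
    (bound t (suc j) (trans (+-suc (suc t) j) eq))
    (≤-trans (+-monoʳ-≤ (2 * r (suc t)) (2^≤d j eq))
      (2*r+d≤r (s≤s z≤n) (subst (λ n → suc t ≤ n ∸ 1) eq (m≤m+n (suc t) j))))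

proposition5p1 : (h : ℕ) (r : ℕ → ℕ) → 2 ≤ h →
    (∀ i → i < h → r i < r (1 + i)) →
    IsMinGenNS (first (1 + h) r) →
    IsPlaneCurveSemigroup h r →
    5 * 2 ^ (2 * h ∸ 1) ≤ 3 * r h + 1
-- The bound holds already for h = 1; the monotonicity hypothesis repeats part of IsTelescopic.
proposition5p1 zero    r () _ _ _
proposition5p1 (suc t) r _  _ minGen pc =
  subst (λ n → 5 * 2 ^ n ≤ 3 * r (suc t) + 1) (sym 2[1+t]∸1≡t+[1+t])
    (bound t 0 (+-identityʳ (suc t)))
  where
  open PlaneCurveSemigroup pc (IsMinGenNS⇒head>0 minGen)
  2[1+t]∸1≡t+[1+t] : 2 * suc t ∸ 1 ≡ t + suc t
  2[1+t]∸1≡t+[1+t] = cong (t +_) (+-identityʳ (suc t))
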